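{- Let $\mathcal S$ be a combinatorial $d$-sphere and let $\mathcal V$ be a gradient vector field on $\mathcal S$ with exactly two critical simplices, one $d$-dimensional and one $0$-dimensional. If $\tau$ is the $d$-dimensional critical simplex, then $\partial_d\big(\overrightarrow{\tau}^{(\mathcal V)}\big)=0$.
   Context: A simplicial complex is a finite nonempty collection of finite sets closed under subsets (so it contains $\emptyset$); $\dim\sigma=|\sigma|-1$; $\alpha$ is a facet of $\beta$ if $\alpha\subseteq\beta$ and $\dim\alpha=\dim\beta-1$. A total order on the vertices is fixed; a $q$-simplex with vertices $x_0<\dots<x_q$ is the oriented simplex $[x_0,\dots,x_q]$; $C_q$ is the free $\mathbb Z$-module on the $q$-simplices. For a $q$-simplex $\sigma=[x_0,\dots,x_q]$ and a $(q-1)$-simplex $\tau$ ($\tau=\emptyset$ if $q=0$), $[\sigma,\tau]=(-1)^i$ if $\tau=\sigma\setminus\{x_i\}$, $0$ if $\tau\not\subseteq\sigma$; $\partial_q\sigma=\sum_\tau[\sigma,\tau]\tau$ for $q\ge1$, $\partial_0=0$. A discrete vector field $\mathcal V$ is a set of pairs $(\alpha,\beta)$ of simplices ($\alpha=\emptyset$ allowed) with $\alpha$ a facet of $\beta$, each simplex in at most one pair. A $\mathcal V$-trajectory $P:\beta_0,\alpha_1,\beta_1,\dots,\alpha_r,\beta_r$ ($r\ge0$) consists of alternately $q$- and $(q-1)$-simplices with $(\alpha_i,\beta_i)\in\mathcal V$, $\alpha_i\subsetneq\beta_{i-1}$, $\beta_{i-1}\ne\beta_i$; $\mathbf i(P)=\beta_0$,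 $\mathbf t(P)=\beta_r$, $w(P)=\prod_{i=1}^r(-[\beta_{i-1},\alpha_i][\beta_i,\alpha_i])$ ($1$ if $r=0$); nontrivial closed if $r>0$, $\beta_r=\beta_0$. A gradient vector field has no nontrivial closed trajectory. A nonempty simplex is critical if it lies in no pair, or is a $0$-simplex $\sigma$ with $(\emptyset,\sigma)\in\mathcal V$. For $\sigma$ critical, $\overrightarrow{\sigma}^{(\mathcal V)}=\sum_{P:\ \mathbf i(P)=\sigma}w(P)\,\mathbf t(P)$ over all $\mathcal V$-trajectories starting at $\sigma$. A $d$-dimensional pseudomanifold: all maximal simplices have dimension $d$, every $(d-1)$-simplex lies in exactly two $d$-simplices, and any two $d$-simplices are joined by a sequence of $d$-simplices with consecutive ones meeting in a $(d-1)$-simplex. A combinatorial $d$-sphere is a $d$-dimensional pseudomanifold admitting a gradient vector field with exactly two critical simplices, one $d$-dimensional and one $0$-dimensional. -}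

module Defs where

open import Data.Nat using (ℕ; zero; suc; _<_)
open import Data.Integer using (ℤ; 0ℤ; 1ℤ; -_; _+_; _*_)
open import Data.List using (List; []; _∷_; length; map; foldr)
open import Data.List.Properties using (≡-dec)
open import Data.List.Relation.Unary.Linked using (Linked)
open import Data.List.Relation.Unary.Unique.Propositional using (Unique)
open import Data.List.Membership.Propositional using (_∈_)
open import Data.Product using (Σ; _×_; _,_; ∃; ∃-syntax; proj₁; proj₂)
open import Data.Sum using (_⊎_)
open import Data.Bool using (if_then_else_)
open import Relation.Nullary using (¬_; does)
open import Relation.Binary.PropositionalEquality using (_≡_)
import Data.Nat as ℕ

-- A simplex {x₀ < … < x_q} is the strictly increasing list [x₀,…,x_q];
-- the empty simplex is [].  dim σ = length σ − 1, i.e. a q-simplex has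
-- length (suc q).

Simplex : Set
Simplex = List ℕ

IsSimplex : Simplex → Set
IsSimplex σ = Linked _<_ σ

_≟S_ : (σ τ : Simplex) → Relation.Nullary.Dec (σ ≡ τ)
_≟S_ = ≡-dec ℕ._≟_

_⊆_ : Simplex → Simplex → Set
α ⊆ β = ∀ {x} → x ∈ α → x ∈ β

_⊊_ : Simplex → Simplex → Set
α ⊊ β = (α ⊆ β) × ¬ (α ≡ β)

IsFacet : Simplex → Simplex → Set
IsFacet α β = (α ⊆ β) × (length β ≡ suc (length α))

record SimplicialComplex : Set where
  field
    simplices : List Simplex
    sorted    : ∀ {σ} → σ ∈ simplices → IsSimplex σ
    nonempty  : ∃[ σ ] (σ ∈ simplices)
    closed    : ∀ {σ α} → σ ∈ simplices → IsSimplex α → α ⊆ σ → α ∈ simplices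
open SimplicialComplex public

_∈S_ : Simplex → SimplicialComplex → Set
σ ∈S S = σ ∈ simplices S

-- Incidence number [σ,τ]: for σ = [x₀,…,x_q], [σ,τ] = (-1)^i if
-- τ = σ ∖ {x_i}, and 0 otherwise.

inc : Simplex → Simplex → ℤ
inc []       τ = 0ℤ
inc (x ∷ xs) τ with does (τ ≟S xs)
... | Data.Bool.true  = 1ℤ
... | Data.Bool.false with τ
...   | []      = 0ℤ
...   | y ∷ τ' = if does (x ℕ.≟ y) then - inc xs τ' else 0ℤ

-- Chains: formal ℤ-linear combinations of simplices, given as finite
-- lists of (coefficient, simplex); coefficients of equal simplices add.

Chain : Set
Chain = List (ℤ × Simplex)

sumℤ : List ℤ → ℤ
sumℤ = foldr _+_ 0ℤ

-- coefficient of the (q−1)-simplex ρ in ∂_q c;  ∂_0 = 0,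
-- ∂_q σ = Σ_τ [σ,τ] τ for q ≥ 1, extended linearly.
∂-coeff : ℕ → Chain → Simplex → ℤ
∂-coeff zero    c ρ = 0ℤ
∂-coeff (suc q) c ρ = sumℤ (map (λ p → proj₁ p * inc (proj₂ p) ρ) c)

Pairs : Set
Pairs = List (Simplex × Simplex)

OccursIn : Simplex → Simplex × Simplex → Set
OccursIn σ (α , β) = (σ ≡ α) ⊎ (σ ≡ β)

record DiscreteVF (S : SimplicialComplex) (V : Pairs) : Set where
  field
    inS     : ∀ {α β} → (α , β) ∈ V → (α ∈S S) × (β ∈S S)
    facet   : ∀ {α β} → (α , β) ∈ V → IsFacet α β
    atMost1 : ∀ {p p' σ} → p ∈ V → p' ∈ V → OccursIn σ p → OccursIn σ p' → p ≡ p'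

-- A V-trajectory β₀, α₁, β₁, …, α_r, β_r is given by β₀ and the list of
-- steps (α₁,β₁) ∷ … ∷ (α_r,β_r).
IsTraj : Pairs → Simplex → List (Simplex × Simplex) → Set
IsTraj V β₀ []              = Data.Unit.⊤
  where import Data.Unit
IsTraj V β₀ ((α , β) ∷ st) =
  ((α , β) ∈ V) × (length β₀ ≡ suc (length α)) × (α ⊊ β₀)
  × ¬ (β₀ ≡ β) × IsTraj V β st

term : Simplex → List (Simplex × Simplex) → Simplex
term β₀ []              = β₀
term β₀ ((α , β) ∷ st) = term β st

weight : Simplex → List (Simplex × Simplex) → ℤ
weight β₀ []              = 1ℤ
weight β₀ ((α , β) ∷ st) = (- (inc β₀ α * inc β α)) * weight β st

Gradient : SimplicialComplex → Pairs → Set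
Gradient S V = ∀ {β₀ α β st} → β₀ ∈S S → IsTraj V β₀ ((α , β) ∷ st)
             → ¬ (term β₀ ((α , β) ∷ st) ≡ β₀)

Critical : SimplicialComplex → Pairs → Simplex → Set
Critical S V σ = (σ ∈S S) × ¬ (σ ≡ [])
  × ((∀ {p} → p ∈ V → ¬ OccursIn σ p) ⊎ ((length σ ≡ 1) × (([] , σ) ∈ V)))

TwoCritical : ℕ → SimplicialComplex → Pairs → Set
TwoCritical d S V = Σ Simplex λ τ → Σ Simplex λ v →
  Critical S V τ × (length τ ≡ suc d) × Critical S V v × (length v ≡ 1)
  × ¬ (τ ≡ v) × (∀ {σ} → Critical S V σ → (σ ≡ τ) ⊎ (σ ≡ v))

Adjacent : ℕ → SimplicialComplex → Simplex → Simplex → Set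
Adjacent d S σ σ' = Σ Simplex λ ρ → (ρ ∈S S) × (length ρ ≡ d) × (ρ ⊆ σ) × (ρ ⊆ σ')

data Joined (d : ℕ) (S : SimplicialComplex) : Simplex → Simplex → Set where
  here : ∀ {σ} → Joined d S σ σ
  step : ∀ {σ σ'' σ'} → σ'' ∈S S → length σ'' ≡ suc d
       → Adjacent d S σ σ'' → Joined d S σ'' σ' → Joined d S σ σ'

record Pseudomanifold (d : ℕ) (S : SimplicialComplex) : Set where
  field
    pure     : ∀ {σ} → σ ∈S S → (∀ {σ'} → σ' ∈S S → ¬ (σ ⊊ σ')) → length σ ≡ suc d
    twoCofaces : ∀ {ρ} → ρ ∈S S → length ρ ≡ d →
      Σ Simplex λ σ₁ → Σ Simplex λ σ₂ →
        (σ₁ ∈S S) × (length σ₁ ≡ suc d) × (ρ ⊆ σ₁)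
        × (σ₂ ∈S S) × (length σ₂ ≡ suc d) × (ρ ⊆ σ₂) × ¬ (σ₁ ≡ σ₂)
        × (∀ {σ} → σ ∈S S → length σ ≡ suc d → ρ ⊆ σ → (σ ≡ σ₁) ⊎ (σ ≡ σ₂))
    connected : ∀ {σ σ'} → σ ∈S S → length σ ≡ suc d → σ' ∈S S → length σ' ≡ suc d
              → Joined d S σ σ'

record CombSphere (d : ℕ) (S : SimplicialComplex) : Set where
  field
    pseudo : Pseudomanifold d S
    field₀ : Σ Pairs λ W → DiscreteVF S W × Gradient S W × TwoCritical d S W

-- The chain →τ^(V) = Σ_{P : i(P) = τ} w(P) t(P), given a duplicate-free
-- list Ps enumerating all V-trajectories starting at τ.

EnumeratesTraj : Pairs → Simplex → List (List (Simplex × Simplex)) → Set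
EnumeratesTraj V τ Ps = Unique Ps × (∀ {st} → st ∈ Ps → IsTraj V τ st)
                      × (∀ {st} → IsTraj V τ st → st ∈ Ps)

flowChain : Simplex → List (List (Simplex × Simplex)) → Chain
flowChain τ Ps = map (λ st → weight τ st , term τ st) Ps

{-# OPTIONS --safe #-}

-- Write c(α) for the coefficient of α in ∂(→τ).  If α is the lower simplex of a pair (α , β), the
-- trajectories ending at β are exactly the extensions through (α , β) of those that do not, and
-- since [β,α]² = 1 their contributions to c(α) cancel the others: c(α) = 0.  So every α with
-- c(α) ≠ 0 is critical or the upper simplex of a pair (a , α).  In dimension 1 this forces α to be
-- the critical vertex v, and ∂∂ = 0 evaluated at ∅ gives c(v) = 0.  In dimension ≥ 2 every such α
-- is paired down, and ∂∂ = 0 evaluated at a yields α′ ⊃ a with c(α′) ≠ 0, i.e. a trajectory step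
-- α′ → α; iterating inside the finite complex closes a trajectory, contradicting gradience.

module Submission where

open import Defs
open import Algebra.Bundles using (CommutativeMonoid)
open import Data.Bool using (if_then_else_)
open import Data.Integer using (ℤ; 0ℤ; 1ℤ; -_; _+_; _-_; _*_)
import Data.Integer.Properties as ℤ
import Algebra.Properties.CommutativeSemigroup ℤ.+-commutativeSemigroup as +-CS
open import Data.List using (List; []; _∷_; length; map; filter; deduplicate; _++_; _∷ʳ_; InitLast; initLast; _∷ʳ′_)
open import Data.List.Properties using (map-∘; ∷-injective; filter-notAll; length-map; ∷ʳ-injectiveˡ)
open import Data.List.Membership.DecPropositional _≟S_ using (_∈?_)
open import Data.List.Membership.Propositional using (_∈_; _∉_; find)
open import Data.List.Membership.Propositional.Properties
  using (∈-filter⁺; ∈-filter⁻; ∈-map⁺; ∈-map⁻; ∈-deduplicate⁺)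
open import Data.List.Membership.Propositional.Properties.WithK using (unique∧set⇒bag)
open import Data.List.Relation.Binary.BagAndSetEquality using (∼bag⇒↭)
open import Data.List.Relation.Binary.Permutation.Propositional using (_↭_; ↭⇒↭ₛ)
import Data.List.Relation.Binary.Permutation.Propositional.Properties as ↭
open import Data.List.Relation.Binary.Permutation.Setoid.Properties using (foldr-commMonoid)
open import Data.List.Relation.Unary.All as All using (All; _∷_)
open import Data.List.Relation.Unary.All.Properties using (¬All⇒Any¬)
import Data.List.Relation.Unary.AllPairs as AllPairs
open import Data.List.Relation.Unary.Any as Any using (here; there; any?)
open import Data.List.Relation.Unary.Linked using ([]; [-]; _∷_)
open import Data.List.Relation.Unary.Linked.Properties using (Linked⇒All; Linked⇒AllPairs)
open import Data.List.Relation.Unary.Unique.Propositional using (Unique; []; _∷_)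
import Data.List.Relation.Unary.Unique.Propositional.Properties as Unique
import Data.List.Relation.Unary.Unique.DecPropositional.Properties as DecUnique
open import Data.Nat as ℕ using (ℕ; zero; suc; _<_; _≤_; z≤n; s≤s)
import Data.Nat.Properties as ℕ
open import Data.Product using (_×_; _,_; proj₁; proj₂; ∃-syntax)
open import Data.Sum using (_⊎_; inj₁; inj₂; [_,_]′)
open import Data.Unit using (tt)
open import Function using (id; _∘_; _⇔_; mk⇔; Equivalence)
open import Relation.Binary using (DecidableEquality)
open import Relation.Binary.PropositionalEquality
open import Relation.Nullary using (¬_; Dec; yes; no; ¬?; does; contradiction)
open import Relation.Nullary.Decidable using (_⊎-dec_; dec-true; dec-false; decidable-stable)
open import Relation.Unary using (Decidable)

*≢0⇒≢0 : ∀ i j → ¬ i * j ≡ 0ℤ → ¬ i ≡ 0ℤ × ¬ j ≡ 0ℤ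
*≢0⇒≢0 i j ij≢0 = (λ { refl → ij≢0 refl }) , (λ { refl → ij≢0 (ℤ.*-zeroʳ i) })

∑ : {A : Set} → List A → (A → ℤ) → ℤ
∑ L f = sumℤ (map f L)

infix 5 ∑
syntax ∑ L (λ x → e) = ∑[ x ∈ L ] e

module _ {A : Set} where

  ∑-cong : ∀ (L : List A) {f g : A → ℤ} → (∀ {x} → x ∈ L → f x ≡ g x) → ∑ L f ≡ ∑ L g
  ∑-cong []      f≡g = refl
  ∑-cong (x ∷ L) f≡g = cong₂ _+_ (f≡g (here refl)) (∑-cong L (f≡g ∘ there))

  ∑-zero : ∀ (L : List A) {f : A → ℤ} → (∀ {x} → x ∈ L → f x ≡ 0ℤ) → ∑ L f ≡ 0ℤ
  ∑-zero []      f≡0 = refl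
  ∑-zero (x ∷ L) f≡0 = cong₂ _+_ (f≡0 (here refl)) (∑-zero L (f≡0 ∘ there))

  ∑-+ : ∀ (L : List A) (f g : A → ℤ) → ∑[ x ∈ L ] (f x + g x) ≡ ∑ L f + ∑ L g
  ∑-+ []      f g = refl
  ∑-+ (x ∷ L) f g = trans (cong (f x + g x +_) (∑-+ L f g)) (+-CS.interchange (f x) (g x) (∑ L f) (∑ L g))

  ∑-neg : ∀ (L : List A) (f : A → ℤ) → ∑[ x ∈ L ] - f x ≡ - ∑ L f
  ∑-neg []      f = refl
  ∑-neg (x ∷ L) f = trans (cong (- f x +_) (∑-neg L f)) (sym (ℤ.neg-distrib-+ (f x) (∑ L f)))

  ∑-*ˡ : ∀ (L : List A) (k : ℤ) (f : A → ℤ) → ∑[ x ∈ L ] k * f x ≡ k * ∑ L f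
  ∑-*ˡ []      k f = sym (ℤ.*-zeroʳ k)
  ∑-*ˡ (x ∷ L) k f = trans (cong (k * f x +_) (∑-*ˡ L k f)) (sym (ℤ.*-distribˡ-+ k (f x) (∑ L f)))

  ∑-*ʳ : ∀ (L : List A) (k : ℤ) (f : A → ℤ) → ∑[ x ∈ L ] f x * k ≡ ∑ L f * k
  ∑-*ʳ L k f = begin
    ∑[ x ∈ L ] f x * k ≡⟨ ∑-cong L (λ {x} _ → ℤ.*-comm (f x) k) ⟩
    ∑[ x ∈ L ] k * f x ≡⟨ ∑-*ˡ L k f ⟩
    k * ∑ L f          ≡⟨ ℤ.*-comm k (∑ L f) ⟩
    ∑ L f * k          ∎
    where open ≡-Reasoning

  ∑≢0⇒∃≢0 : ∀ (L : List A) (f : A → ℤ) → ¬ ∑ L f ≡ 0ℤ → ∃[ x ] (x ∈ L × ¬ f x ≡ 0ℤ)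
  ∑≢0⇒∃≢0 L f ∑≢0 with All.all? (λ x → f x ℤ.≟ 0ℤ) L
  ... | yes all≡0 = contradiction (∑-zero L (All.lookup all≡0)) ∑≢0
  ... | no ¬all≡0 = find (¬All⇒Any¬ (λ x → f x ℤ.≟ 0ℤ) L ¬all≡0)

  ∑-↭ : ∀ {L M : List A} (f : A → ℤ) → L ↭ M → ∑ L f ≡ ∑ M f
  ∑-↭ f L↭M = foldr-commMonoid +-0.setoid +-0.isCommutativeMonoid (↭⇒↭ₛ (↭.map⁺ f L↭M))
    where module +-0 = CommutativeMonoid ℤ.+-0-commutativeMonoid

  ∑-single : ∀ {L : List A} (f : A → ℤ) {y : A} → Unique L → y ∈ L
           → (∀ {x} → x ∈ L → ¬ x ≡ y → f x ≡ 0ℤ) → ∑ L f ≡ f y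
  ∑-single f (y∉L ∷ _) (here refl) f≡0 =
    trans (cong (f _ +_) (∑-zero _ (λ x∈L → f≡0 (there x∈L) (λ { refl → All.lookup y∉L x∈L refl }))))
          (ℤ.+-identityʳ _)
  ∑-single f (x∉L ∷ uL) (there y∈L) f≡0 =
    trans (cong₂ _+_ (f≡0 (here refl) (λ { refl → All.lookup x∉L y∈L refl })) (∑-single f uL y∈L (f≡0 ∘ there)))
          (ℤ.+-identityˡ _)

  ∑≡0⇒∃≢0-elsewhere : DecidableEquality A → ∀ {L : List A} (f : A → ℤ) {y : A} → Unique L → y ∈ L
                    → ∑ L f ≡ 0ℤ → ¬ f y ≡ 0ℤ → ∃[ x ] (x ∈ L × ¬ x ≡ y × ¬ f x ≡ 0ℤ)
  ∑≡0⇒∃≢0-elsewhere _≟_ {L} f {y} uL y∈L ∑≡0 fy≢0 with All.all? (λ x → x ≟ y ⊎-dec f x ℤ.≟ 0ℤ) L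
  ... | yes all = contradiction (trans (sym (∑-single f uL y∈L only-y)) ∑≡0) fy≢0
    where
    only-y : ∀ {x} → x ∈ L → ¬ x ≡ y → f x ≡ 0ℤ
    only-y x∈L x≢y with All.lookup all x∈L
    ... | inj₁ x≡y  = contradiction x≡y x≢y
    ... | inj₂ fx≡0 = fx≡0
  ... | no ¬all with find (¬All⇒Any¬ (λ x → x ≟ y ⊎-dec f x ℤ.≟ 0ℤ) L ¬all)
  ...   | x , x∈L , ¬[x≡y⊎fx≡0] = x , x∈L , ¬[x≡y⊎fx≡0] ∘ inj₁ , ¬[x≡y⊎fx≡0] ∘ inj₂

  module _ {P : A → Set} (P? : Decidable P) where

    ∑-filter : ∀ (L : List A) (f : A → ℤ) → (∀ {x} → x ∈ L → ¬ P x → f x ≡ 0ℤ)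
             → ∑ (filter P? L) f ≡ ∑ L f
    ∑-filter []      f f≡0 = refl
    ∑-filter (x ∷ L) f f≡0 with P? x
    ... | yes _  = cong (f x +_) (∑-filter L f (f≡0 ∘ there))
    ... | no ¬px = trans (∑-filter L f (f≡0 ∘ there))
                         (sym (trans (cong (_+ ∑ L f) (f≡0 (here refl) ¬px)) (ℤ.+-identityˡ _)))

    ∑-partition : ∀ (L : List A) (f : A → ℤ) → ∑ L f ≡ ∑ (filter P? L) f + ∑ (filter (¬? ∘ P?) L) f
    ∑-partition []      f = refl
    ∑-partition (x ∷ L) f with P? x
    ... | yes _ = trans (cong (f x +_) (∑-partition L f)) (sym (ℤ.+-assoc (f x) (∑ (filter P? L) f) _))
    ... | no _  = trans (cong (f x +_) (∑-partition L f)) (+-CS.x∙yz≈y∙xz (f x) (∑ (filter P? L) f) _)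

  ∑-same-support : ∀ {L M : List A} (f : A → ℤ) → Unique L → Unique M
         → (∀ {x} → ¬ f x ≡ 0ℤ → (x ∈ L ⇔ x ∈ M)) → ∑ L f ≡ ∑ M f
  ∑-same-support {L} {M} f uL uM same = begin
    ∑ L f              ≡⟨ ∑-filter nz? L f (λ _ → decidable-stable (f _ ℤ.≟ 0ℤ)) ⟨
    ∑ (filter nz? L) f ≡⟨ ∑-↭ f (∼bag⇒↭ (unique∧set⇒bag (Unique.filter⁺ nz? uL) (Unique.filter⁺ nz? uM) supp)) ⟩
    ∑ (filter nz? M) f ≡⟨ ∑-filter nz? M f (λ _ → decidable-stable (f _ ℤ.≟ 0ℤ)) ⟩
    ∑ M f              ∎
    where
    open ≡-Reasoning
    nz? : Decidable (λ x → ¬ f x ≡ 0ℤ)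
    nz? x = ¬? (f x ℤ.≟ 0ℤ)
    supp : ∀ {x} → x ∈ filter nz? L ⇔ x ∈ filter nz? M
    supp = mk⇔ (λ x∈ → let x∈L , fx≢0 = ∈-filter⁻ nz? x∈ in ∈-filter⁺ nz? (Equivalence.to (same fx≢0) x∈L) fx≢0)
               (λ x∈ → let x∈M , fx≢0 = ∈-filter⁻ nz? x∈ in ∈-filter⁺ nz? (Equivalence.from (same fx≢0) x∈M) fx≢0)

module _ {A B : Set} where

  ∑-map : ∀ (L : List A) (g : A → B) (f : B → ℤ) → ∑ (map g L) f ≡ ∑ L (f ∘ g)
  ∑-map L g f = cong sumℤ (sym (map-∘ L))

  ∑-comm : ∀ (L : List A) (M : List B) (h : A → B → ℤ)
         → ∑[ a ∈ L ] ∑ M (h a) ≡ ∑[ b ∈ M ] ∑[ a ∈ L ] h a b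
  ∑-comm []      M h = sym (∑-zero M (λ _ → refl))
  ∑-comm (a ∷ L) M h = trans (cong (∑ M (h a) +_) (∑-comm L M h)) (sym (∑-+ M (h a) _))

head<tail : ∀ {x xs} → IsSimplex (x ∷ xs) → ∀ {y} → y ∈ xs → x < y
head<tail {xs = []}    _              ()
head<tail {xs = _ ∷ _} (x<y ∷ sorted) = All.lookup (Linked⇒All ℕ.<-trans x<y sorted)

head∉tail : ∀ {x xs} → IsSimplex (x ∷ xs) → x ∉ xs
head∉tail sorted x∈xs = ℕ.<-irrefl refl (head<tail sorted x∈xs)

∷-sorted : ∀ {x α} → IsSimplex α → (∀ {y} → y ∈ α → x < y) → IsSimplex (x ∷ α)
∷-sorted []       x<α = [-]
∷-sorted [-]      x<α = x<α (here refl) ∷ [-]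
∷-sorted (r ∷ rs) x<α = x<α (here refl) ∷ r ∷ rs

tail-sorted : ∀ {x xs} → IsSimplex (x ∷ xs) → IsSimplex xs
tail-sorted [-]          = []
tail-sorted (_ ∷ sorted) = sorted

sorted⇒unique : ∀ {σ} → IsSimplex σ → Unique σ
sorted⇒unique sorted = AllPairs.map ℕ.<⇒≢ (Linked⇒AllPairs ℕ.<-trans sorted)

⊆-∷⁻ : ∀ {b ρ σ} → ρ ⊆ (b ∷ σ) → b ∉ ρ → ρ ⊆ σ
⊆-∷⁻ ρ⊆bσ b∉ρ x∈ρ with ρ⊆bσ x∈ρ
... | here refl = contradiction x∈ρ b∉ρ
... | there x∈σ = x∈σ

unique⊆⇒length≤ : ∀ {A : Set} → DecidableEquality A → ∀ {L M : List A}
                → Unique L → (∀ {x} → x ∈ L → x ∈ M) → length L ≤ length M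
unique⊆⇒length≤ _≟_ {[]}    _          _   = z≤n
unique⊆⇒length≤ _≟_ {x ∷ L} {M} (x∉L ∷ uL) L⊆M =
  ℕ.<-≤-trans (s≤s (unique⊆⇒length≤ _≟_ uL L⊆M-x))
              (filter-notAll ≢x? M (Any.map (λ x≡y x≢y → x≢y (sym x≡y)) (L⊆M (here refl))))
  where
  ≢x? = λ y → ¬? (y ≟ x)
  L⊆M-x : ∀ {y} → y ∈ L → y ∈ filter ≢x? M
  L⊆M-x y∈L = ∈-filter⁺ ≢x? (L⊆M (there y∈L)) (λ { refl → All.lookup x∉L y∈L refl })

sorted-⊆-length≡⇒≡ : ∀ {ρ σ} → IsSimplex ρ → IsSimplex σ → ρ ⊆ σ → length ρ ≡ length σ → ρ ≡ σ
sorted-⊆-length≡⇒≡ {[]}    {[]}    _  _  _   _   = refl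
sorted-⊆-length≡⇒≡ {a ∷ ρ} {b ∷ σ} sρ sσ ρ⊆σ len with a ℕ.≟ b
... | yes refl = cong (a ∷_) (sorted-⊆-length≡⇒≡ (tail-sorted sρ) (tail-sorted sσ)
                   (⊆-∷⁻ (ρ⊆σ ∘ there) (head∉tail sρ)) (ℕ.suc-injective len))
... | no a≢b with ρ⊆σ (here refl)
...   | here a≡b = contradiction a≡b a≢b
...   | there a∈σ =
  contradiction (s≤s (unique⊆⇒length≤ ℕ._≟_ (sorted⇒unique sρ) (⊆-∷⁻ ρ⊆σ b∉aρ))) (ℕ.<-irrefl len)
  where
  b∉aρ : b ∉ a ∷ ρ
  b∉aρ (here b≡a)  = a≢b (sym b≡a)
  b∉aρ (there b∈ρ) = ℕ.<-asym (head<tail sρ b∈ρ) (head<tail sσ a∈σ)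

inc-∷-tail : ∀ x xs → inc (x ∷ xs) xs ≡ 1ℤ
inc-∷-tail x xs rewrite dec-true (xs ≟S xs) refl = refl

inc-∷-[] : ∀ x xs → ¬ [] ≡ xs → inc (x ∷ xs) [] ≡ 0ℤ
inc-∷-[] x xs []≢xs rewrite dec-false ([] ≟S xs) []≢xs = refl

inc-∷-∷-same : ∀ x xs γ → ¬ x ∷ γ ≡ xs → inc (x ∷ xs) (x ∷ γ) ≡ - inc xs γ
inc-∷-∷-same x xs γ ≢xs rewrite dec-false ((x ∷ γ) ≟S xs) ≢xs | dec-true (x ℕ.≟ x) refl = refl

inc-∷-∷-other : ∀ x xs y γ → ¬ y ∷ γ ≡ xs → ¬ x ≡ y → inc (x ∷ xs) (y ∷ γ) ≡ 0ℤ
inc-∷-∷-other x xs y γ ≢xs x≢y rewrite dec-false ((y ∷ γ) ≟S xs) ≢xs | dec-false (x ℕ.≟ y) x≢y = refl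

δ : Simplex → Simplex → ℤ
δ f α = if does (f ≟S α) then 1ℤ else 0ℤ

δ-refl : ∀ f → δ f f ≡ 1ℤ
δ-refl f rewrite dec-true (f ≟S f) refl = refl

δ-≢ : ∀ {f α} → ¬ f ≡ α → δ f α ≡ 0ℤ
δ-≢ {f} {α} f≢α rewrite dec-false (f ≟S α) f≢α = refl

δ-∷ : ∀ x f α → δ (x ∷ f) (x ∷ α) ≡ δ f α
δ-∷ x f α = by-cases (f ≟S α)
  where
  -- A `with` on f ≟S α would also abstract that test inside δ (x ∷ f) (x ∷ α) and get stuck.
  by-cases : Dec (f ≡ α) → δ (x ∷ f) (x ∷ α) ≡ δ f α
  by-cases (yes refl) = trans (δ-refl (x ∷ f)) (sym (δ-refl f))
  by-cases (no f≢α)   = trans (δ-≢ {x ∷ f} {x ∷ α} (f≢α ∘ proj₂ ∘ ∷-injective)) (sym (δ-≢ f≢α))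

δ≢0⇒≡ : ∀ {f α} → ¬ δ f α ≡ 0ℤ → f ≡ α
δ≢0⇒≡ {f} {α} δ≢0 = by-cases (f ≟S α)
  where
  by-cases : Dec (f ≡ α) → f ≡ α
  by-cases (yes f≡α) = f≡α
  by-cases (no f≢α)  = contradiction (δ-≢ f≢α) δ≢0

inc-∷-off-head : ∀ x f γ → (∀ γ′ → ¬ γ ≡ x ∷ γ′) → inc (x ∷ f) γ ≡ δ f γ
inc-∷-off-head x f γ off = by-cases γ off (γ ≟S f)
  where
  by-cases : ∀ γ → (∀ γ′ → ¬ γ ≡ x ∷ γ′) → Dec (γ ≡ f) → inc (x ∷ f) γ ≡ δ f γ
  by-cases γ        _   (yes refl) = trans (inc-∷-tail x γ) (sym (δ-refl γ))
  by-cases []       _   (no []≢f)  = trans (inc-∷-[] x f []≢f) (sym (δ-≢ ([]≢f ∘ sym)))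
  by-cases (y ∷ γ′) off (no γ≢f) with x ℕ.≟ y
  ... | yes refl = contradiction refl (off γ′)
  ... | no x≢y   = trans (inc-∷-∷-other x f y γ′ γ≢f x≢y) (sym (δ-≢ (γ≢f ∘ sym)))

⟨_,_⟩ : Chain → (Simplex → ℤ) → ℤ
⟨ c , g ⟩ = ∑[ p ∈ c ] proj₁ p * g (proj₂ p)

⟨⟩-cong : ∀ c {g h : Simplex → ℤ} → (∀ {p} → p ∈ c → g (proj₂ p) ≡ h (proj₂ p))
        → ⟨ c , g ⟩ ≡ ⟨ c , h ⟩
⟨⟩-cong c g≡h = ∑-cong c (λ {p} p∈c → cong (proj₁ p *_) (g≡h p∈c))

⟨⟩-zero : ∀ c {g : Simplex → ℤ} → (∀ {p} → p ∈ c → g (proj₂ p) ≡ 0ℤ) → ⟨ c , g ⟩ ≡ 0ℤ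
⟨⟩-zero c g≡0 = ∑-zero c (λ {p} p∈c → trans (cong (proj₁ p *_) (g≡0 p∈c)) (ℤ.*-zeroʳ (proj₁ p)))

⟨⟩-neg : ∀ c (g : Simplex → ℤ) → ⟨ c , (λ σ → - g σ) ⟩ ≡ - ⟨ c , g ⟩
⟨⟩-neg c g = trans (∑-cong c (λ {p} _ → sym (ℤ.neg-distribʳ-* (proj₁ p) (g (proj₂ p)))))
                   (∑-neg c (λ p → proj₁ p * g (proj₂ p)))

cone : ℕ → ℤ × Simplex → ℤ × Simplex
cone x (k , f) = - k , x ∷ f

-- The cone formula ∂(x ⋆ σ) = σ − x ⋆ ∂σ, where x ⋆ σ = x ∷ σ for x below all vertices of σ.
boundary : Simplex → Chain
boundary []       = []
boundary (x ∷ xs) = (1ℤ , xs) ∷ map (cone x) (boundary xs)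

⟨boundary-∷⟩ : ∀ x xs g → ⟨ boundary (x ∷ xs) , g ⟩ ≡ g xs - ⟨ boundary xs , g ∘ (x ∷_) ⟩
⟨boundary-∷⟩ x xs g = cong₂ _+_ (ℤ.*-identityˡ (g xs)) (begin
  ∑[ p ∈ map (cone x) (boundary xs) ] proj₁ p * g (proj₂ p)
    ≡⟨ ∑-map (boundary xs) (cone x) _ ⟩
  ∑[ p ∈ boundary xs ] (- proj₁ p) * g (x ∷ proj₂ p)
    ≡⟨ ∑-cong (boundary xs) (λ {p} _ → sym (ℤ.neg-distribˡ-* (proj₁ p) _)) ⟩
  ∑[ p ∈ boundary xs ] - (proj₁ p * g (x ∷ proj₂ p))
    ≡⟨ ∑-neg (boundary xs) _ ⟩
  - ⟨ boundary xs , g ∘ (x ∷_) ⟩ ∎)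
  where open ≡-Reasoning

boundary-facet : ∀ {σ p} → p ∈ boundary σ → IsFacet (proj₂ p) σ
boundary-facet {x ∷ xs} (here refl) = there , refl
boundary-facet {x ∷ xs} (there p∈) with ∈-map⁻ (cone x) p∈
... | q , q∈ , refl with boundary-facet q∈
...   | f⊆xs , len = (λ { (here x≡) → here x≡ ; (there y∈f) → there (f⊆xs y∈f) }) , cong suc len

boundary-sorted : ∀ {σ p} → IsSimplex σ → p ∈ boundary σ → IsSimplex (proj₂ p)
boundary-sorted {x ∷ xs} sσ (here refl) = tail-sorted sσ
boundary-sorted {x ∷ xs} sσ (there p∈) with ∈-map⁻ (cone x) p∈
... | q , q∈ , refl = ∷-sorted (boundary-sorted (tail-sorted sσ) q∈) (head<tail sσ ∘ proj₁ (boundary-facet q∈))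

inc-as-⟨boundary⟩ : ∀ {σ} → IsSimplex σ → ∀ α → inc σ α ≡ ⟨ boundary σ , (λ f → δ f α) ⟩
inc-as-⟨boundary⟩ {[]}     _  α = refl
inc-as-⟨boundary⟩ {x ∷ xs} sσ α = trans (by-cases α (α ≟S xs)) (sym (⟨boundary-∷⟩ x xs (λ f → δ f α)))
  where
  by-cases : ∀ α → Dec (α ≡ xs) → inc (x ∷ xs) α ≡ δ xs α - ⟨ boundary xs , (λ f → δ (x ∷ f) α) ⟩
  by-cases α (yes refl) = trans (inc-∷-tail x α) (sym (cong₂ _-_ (δ-refl α)
    (⟨⟩-zero (boundary α) (λ {p} _ → δ-≢ {x ∷ proj₂ p} {α}
      (λ x∷f≡xs → head∉tail sσ (subst (x ∈_) x∷f≡xs (here refl)))))))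
  by-cases [] (no []≢xs) = trans (inc-∷-[] x xs []≢xs) (sym (cong₂ _-_ (δ-≢ ([]≢xs ∘ sym))
    (⟨⟩-zero (boundary xs) (λ {p} _ → δ-≢ {x ∷ proj₂ p} {[]} λ ()))))
  by-cases (y ∷ γ) (no ≢xs) with x ℕ.≟ y
  ... | no x≢y = trans (inc-∷-∷-other x xs y γ ≢xs x≢y) (sym (cong₂ _-_ (δ-≢ (≢xs ∘ sym))
    (⟨⟩-zero (boundary xs) (λ {p} _ → δ-≢ {x ∷ proj₂ p} {y ∷ γ} (x≢y ∘ proj₁ ∘ ∷-injective)))))
  ... | yes refl = begin
    inc (x ∷ xs) (x ∷ γ)
      ≡⟨ inc-∷-∷-same x xs γ ≢xs ⟩
    - inc xs γ
      ≡⟨ cong -_ (inc-as-⟨boundary⟩ (tail-sorted sσ) γ) ⟩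
    - ⟨ boundary xs , (λ f → δ f γ) ⟩
      ≡⟨ ℤ.+-identityˡ _ ⟨
    0ℤ - ⟨ boundary xs , (λ f → δ f γ) ⟩
      ≡⟨ cong₂ _-_ (δ-≢ (≢xs ∘ sym)) (⟨⟩-cong (boundary xs) (λ {p} _ → δ-∷ x (proj₂ p) γ)) ⟨
    δ xs (x ∷ γ) - ⟨ boundary xs , (λ f → δ (x ∷ f) (x ∷ γ)) ⟩ ∎
    where open ≡-Reasoning

inc≢0⇒facet : ∀ {σ α} → IsSimplex σ → ¬ inc σ α ≡ 0ℤ → IsSimplex α × IsFacet α σ
inc≢0⇒facet {σ} {α} sσ inc≢0 with ∑≢0⇒∃≢0 (boundary σ) _ (inc≢0 ∘ trans (inc-as-⟨boundary⟩ sσ α))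
... | (k , f) , p∈ , kδ≢0 with refl ← δ≢0⇒≡ {f} {α} (λ δ≡0 → kδ≢0 (trans (cong (k *_) δ≡0) (ℤ.*-zeroʳ k))) =
  boundary-sorted sσ p∈ , boundary-facet p∈

∂∂≡0 : ∀ {σ} → IsSimplex σ → ∀ γ → ⟨ boundary σ , (λ f → inc f γ) ⟩ ≡ 0ℤ
∂∂≡0 {[]}     _  γ = refl
∂∂≡0 {x ∷ xs} sσ γ = trans (⟨boundary-∷⟩ x xs (λ f → inc f γ)) (by-cases γ)
  where
  off-head : ∀ γ → (∀ γ′ → ¬ γ ≡ x ∷ γ′)
           → inc xs γ - ⟨ boundary xs , (λ f → inc (x ∷ f) γ) ⟩ ≡ 0ℤ
  off-head γ off = begin
    inc xs γ - ⟨ boundary xs , (λ f → inc (x ∷ f) γ) ⟩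
      ≡⟨ cong (λ t → inc xs γ - t) (⟨⟩-cong (boundary xs) (λ {p} _ → inc-∷-off-head x (proj₂ p) γ off)) ⟩
    inc xs γ - ⟨ boundary xs , (λ f → δ f γ) ⟩
      ≡⟨ cong (λ t → inc xs γ - t) (inc-as-⟨boundary⟩ (tail-sorted sσ) γ) ⟨
    inc xs γ - inc xs γ
      ≡⟨ ℤ.+-inverseʳ (inc xs γ) ⟩
    0ℤ ∎
    where open ≡-Reasoning
  by-cases : ∀ γ → inc xs γ - ⟨ boundary xs , (λ f → inc (x ∷ f) γ) ⟩ ≡ 0ℤ
  by-cases []      = off-head [] (λ _ ())
  by-cases (y ∷ γ) with x ℕ.≟ y
  ... | no x≢y   = off-head (y ∷ γ) (λ _ y∷γ≡ → x≢y (sym (proj₁ (∷-injective y∷γ≡))))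
  ... | yes refl = begin
    inc xs (x ∷ γ) - ⟨ boundary xs , (λ f → inc (x ∷ f) (x ∷ γ)) ⟩
      ≡⟨ cong₂ _-_ x∉xs (⟨⟩-cong (boundary xs) (λ p∈ → inc-∷-∷-same x _ γ (x∉face p∈))) ⟩
    0ℤ - ⟨ boundary xs , (λ f → - inc f γ) ⟩
      ≡⟨ cong (λ t → 0ℤ - t) (⟨⟩-neg (boundary xs) (λ f → inc f γ)) ⟩
    0ℤ - - ⟨ boundary xs , (λ f → inc f γ) ⟩
      ≡⟨ cong (λ t → 0ℤ - - t) (∂∂≡0 (tail-sorted sσ) γ) ⟩
    0ℤ ∎
    where
    open ≡-Reasoning
    x∉xs : inc xs (x ∷ γ) ≡ 0ℤ
    x∉xs with inc xs (x ∷ γ) ℤ.≟ 0ℤ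
    ... | yes inc≡0 = inc≡0
    ... | no  inc≢0 = contradiction (proj₁ (proj₂ (inc≢0⇒facet (tail-sorted sσ) inc≢0)) (here refl)) (head∉tail sσ)
    x∉face : ∀ {p} → p ∈ boundary xs → ¬ x ∷ γ ≡ proj₂ p
    x∉face p∈ x∷γ≡f = head∉tail sσ (proj₁ (boundary-facet p∈) (subst (x ∈_) x∷γ≡f (here refl)))

facet⇒inc²≡1 : ∀ {β ρ} → IsSimplex β → IsSimplex ρ → IsFacet ρ β → inc β ρ * inc β ρ ≡ 1ℤ
facet⇒inc²≡1 {x ∷ xs} {ρ} sβ sρ (ρ⊆β , len) = by-cases ρ sρ ρ⊆β len (ρ ≟S xs)
  where
  by-cases : ∀ ρ → IsSimplex ρ → ρ ⊆ (x ∷ xs) → suc (length xs) ≡ suc (length ρ) → Dec (ρ ≡ xs)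
           → inc (x ∷ xs) ρ * inc (x ∷ xs) ρ ≡ 1ℤ
  by-cases ρ _ _ _ (yes refl) rewrite inc-∷-tail x ρ = refl
  by-cases [] _ _ len (no []≢xs) =
    contradiction (sorted-⊆-length≡⇒≡ [] (tail-sorted sβ) (λ ()) (sym (ℕ.suc-injective len))) []≢xs
  by-cases (y ∷ ρ) sρ ρ⊆β len (no ≢xs) with x ℕ.≟ y
  ... | yes refl rewrite inc-∷-∷-same x xs ρ ≢xs =
    trans (neg*neg (inc xs ρ))
          (facet⇒inc²≡1 (tail-sorted sβ) (tail-sorted sρ)
                        (⊆-∷⁻ (ρ⊆β ∘ there) (head∉tail sρ) , ℕ.suc-injective len))
    where
    neg*neg : ∀ i → (- i) * (- i) ≡ i * i
    neg*neg i = begin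
      (- i) * (- i) ≡⟨ ℤ.neg-distribˡ-* i (- i) ⟨
      - (i * - i)   ≡⟨ cong -_ (ℤ.neg-distribʳ-* i i) ⟨
      - - (i * i)   ≡⟨ ℤ.neg-involutive (i * i) ⟩
      i * i         ∎
      where open ≡-Reasoning
  ... | no x≢y with ρ⊆β (here refl)
  ...   | here y≡x  = contradiction (sym y≡x) x≢y
  ...   | there y∈xs =
    contradiction (sorted-⊆-length≡⇒≡ sρ (tail-sorted sβ) (⊆-∷⁻ ρ⊆β x∉yρ) (sym (ℕ.suc-injective len))) ≢xs
    where
    x∉yρ : x ∉ y ∷ ρ
    x∉yρ (here x≡y)  = x≢y x≡y
    x∉yρ (there x∈ρ) = ℕ.<-asym (head<tail sβ y∈xs) (head<tail sρ x∈ρ)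

facet⇒inc≢0 : ∀ {β ρ} → IsSimplex β → IsSimplex ρ → IsFacet ρ β → ¬ inc β ρ ≡ 0ℤ
facet⇒inc≢0 sβ sρ facet inc≡0 with trans (sym (facet⇒inc²≡1 sβ sρ facet)) (cong (λ i → i * i) inc≡0)
... | ()

∑-inc≡⟨boundary⟩ : ∀ {σ} → IsSimplex σ → ∀ {A} → Unique A → (∀ {p} → p ∈ boundary σ → proj₂ p ∈ A)
       → ∀ g → ∑[ α ∈ A ] inc σ α * g α ≡ ⟨ boundary σ , g ⟩
∑-inc≡⟨boundary⟩ {σ} sσ {A} uA faces∈A g = begin
  ∑[ α ∈ A ] inc σ α * g α
    ≡⟨ ∑-cong A (λ {α} _ → cong (_* g α) (inc-as-⟨boundary⟩ sσ α)) ⟩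
  ∑[ α ∈ A ] ⟨ boundary σ , (λ f → δ f α) ⟩ * g α
    ≡⟨ ∑-cong A (λ {α} _ → sym (∑-*ʳ (boundary σ) (g α) _)) ⟩
  ∑[ α ∈ A ] ∑[ p ∈ boundary σ ] proj₁ p * δ (proj₂ p) α * g α
    ≡⟨ ∑-comm A (boundary σ) _ ⟩
  ∑[ p ∈ boundary σ ] ∑[ α ∈ A ] proj₁ p * δ (proj₂ p) α * g α
    ≡⟨ ∑-cong (boundary σ) picks-face ⟩
  ⟨ boundary σ , g ⟩ ∎
  where
  open ≡-Reasoning
  picks-face : ∀ {p} → p ∈ boundary σ → ∑[ α ∈ A ] proj₁ p * δ (proj₂ p) α * g α ≡ proj₁ p * g (proj₂ p)
  picks-face {k , f} p∈ = begin
    ∑[ α ∈ A ] k * δ f α * g α ≡⟨ ∑-single (λ α → k * δ f α * g α) uA (faces∈A p∈) off-f ⟩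
    k * δ f f * g f           ≡⟨ cong (λ d → k * d * g f) (δ-refl f) ⟩
    k * 1ℤ * g f              ≡⟨ cong (_* g f) (ℤ.*-identityʳ k) ⟩
    k * g f                   ∎
    where
    off-f : ∀ {α} → α ∈ A → ¬ α ≡ f → k * δ f α * g α ≡ 0ℤ
    off-f {α} _ α≢f rewrite δ-≢ (α≢f ∘ sym) | ℤ.*-zeroʳ k = ℤ.*-zeroˡ (g α)

facet⇒⊊ : ∀ {α β} → IsFacet α β → α ⊊ β
facet⇒⊊ (α⊆β , len) = α⊆β , λ { refl → ℕ.1+n≢n (sym len) }

inc-vertex-[] : ∀ {v} → length v ≡ 1 → inc v [] ≡ 1ℤ
inc-vertex-[] {x ∷ []} _ = inc-∷-tail x []

module _ {S : SimplicialComplex} {V : Pairs} (dvf : DiscreteVF S V) where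
  open DiscreteVF dvf

  term-length : ∀ {b} st → IsTraj V b st → length (term b st) ≡ length b
  term-length []                 _                        = refl
  term-length ((α , β) ∷ st) (αβ∈V , len , _ , _ , traj) =
    trans (term-length st traj) (trans (proj₂ (facet αβ∈V)) (sym len))

  term-∈S : ∀ {b} st → b ∈S S → IsTraj V b st → term b st ∈S S
  term-∈S []             b∈S _                    = b∈S
  term-∈S ((α , β) ∷ st) _   (αβ∈V , _ , _ , _ , traj) = term-∈S st (proj₂ (inS αβ∈V)) traj

  vertex-paired-down-by-∅ : ∀ {a α} → (a , α) ∈ V → length α ≡ 1 → ([] , α) ∈ V
  vertex-paired-down-by-∅ {[]}    aα∈V _   = aα∈V
  vertex-paired-down-by-∅ {_ ∷ _} aα∈V len with trans (sym len) (proj₂ (facet aα∈V))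
  ... | ()

term-++ : ∀ b Q R → term b (Q ++ R) ≡ term (term b Q) R
term-++ b []             R = refl
term-++ b ((α , β) ∷ Q) R = term-++ β Q R

weight-++ : ∀ b Q R → weight b (Q ++ R) ≡ weight b Q * weight (term b Q) R
weight-++ b []             R = sym (ℤ.*-identityˡ (weight b R))
weight-++ b ((α , β) ∷ Q) R = trans (cong (sign *_) (weight-++ β Q R)) (sym (ℤ.*-assoc sign (weight β Q) _))
  where sign = - (inc b α * inc β α)

module _ {V : Pairs} where

  IsTraj-++⁺ : ∀ {b} Q {R} → IsTraj V b Q → IsTraj V (term b Q) R → IsTraj V b (Q ++ R)
  IsTraj-++⁺ []             _                             trajR = trajR
  IsTraj-++⁺ ((α , β) ∷ Q) (αβ∈V , len , α⊊ , ≢β , trajQ) trajR =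
    αβ∈V , len , α⊊ , ≢β , IsTraj-++⁺ Q trajQ trajR

  IsTraj-++⁻ : ∀ {b} Q {R} → IsTraj V b (Q ++ R) → IsTraj V b Q × IsTraj V (term b Q) R
  IsTraj-++⁻ []             traj = tt , traj
  IsTraj-++⁻ ((α , β) ∷ Q) (αβ∈V , len , α⊊ , ≢β , traj) with IsTraj-++⁻ Q traj
  ... | trajQ , trajR = (αβ∈V , len , α⊊ , ≢β , trajQ) , trajR

  prefix-ending-at : ∀ {b} st {x} → IsTraj V b st → x ∈ map proj₂ st
                   → ∃[ s ] ∃[ Q ] (IsTraj V b (s ∷ Q) × term b (s ∷ Q) ≡ x)
  prefix-ending-at ((α , β) ∷ st) (αβ∈V , len , α⊊ , ≢β , _) (here refl) =
    (α , β) , [] , (αβ∈V , len , α⊊ , ≢β , tt) , refl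
  prefix-ending-at ((α , β) ∷ st) (αβ∈V , len , α⊊ , ≢β , traj) (there x∈) with prefix-ending-at st traj x∈
  ... | s , Q , trajQ , ends = (α , β) , s ∷ Q , (αβ∈V , len , α⊊ , ≢β , trajQ) , ends

-- Following backward steps inside the finite complex must revisit a simplex,
-- and the revisited stretch is a nontrivial closed trajectory.
module _ {S : SimplicialComplex} {V : Pairs} (grad : Gradient S V)
         {P : Simplex → Set} (P⇒∈S : ∀ {α} → P α → α ∈S S)
         (step-back : ∀ {α} → P α → ∃[ α′ ] ∃[ a ] (P α′ × IsTraj V α′ ((a , α) ∷ [])))
  where

  private
    extend-backward : ∀ n {α} st → IsTraj V α st → All P (α ∷ map proj₂ st) → Unique (α ∷ map proj₂ st)
                    → length (simplices S) ≤ n ℕ.+ length st → ¬ P α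
    extend-backward zero st _ allP uniq N≤ _ =
      ℕ.<-irrefl refl (ℕ.<-≤-trans
        (unique⊆⇒length≤ _≟S_ uniq (λ x∈ → P⇒∈S (All.lookup allP x∈)))
        (subst (length (simplices S) ≤_) (sym (length-map proj₂ st)) N≤))
    extend-backward (suc n) {α} st traj allP uniq N≤ pα with step-back pα
    ... | α′ , a , pα′ , α′→α with α′ ∈? (α ∷ map proj₂ st)
    ...   | yes α′∈ with prefix-ending-at ((a , α) ∷ st) (IsTraj-++⁺ ((a , α) ∷ []) α′→α traj) α′∈
    ...     | s , Q , closed , ends = grad (P⇒∈S pα′) closed ends
    extend-backward (suc n) {α} st traj allP uniq N≤ pα | α′ , a , pα′ , α′→α | no α′∉ =
      extend-backward n ((a , α) ∷ st) (IsTraj-++⁺ ((a , α) ∷ []) α′→α traj) (pα′ ∷ allP)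
        (All.tabulate (λ x∈ α′≡x → α′∉ (subst (_∈ _) (sym α′≡x) x∈)) ∷ uniq)
        (subst (length (simplices S) ≤_) (sym (ℕ.+-suc n (length st))) N≤) pα′

  gradient⇒no-backward-closed : ∀ {α} → ¬ P α
  gradient⇒no-backward-closed pα =
    extend-backward (length (simplices S)) [] tt (pα ∷ All.[]) (All.[] ∷ [])
                    (ℕ.≤-reflexive (sym (ℕ.+-identityʳ _))) pα

module TwoCriticalFacts {d : ℕ} {S : SimplicialComplex} {V : Pairs} (two : TwoCritical d S V) where

  vertex : Simplex
  vertex = let (_ , v , _) = two in v

  vertex-length : length vertex ≡ 1
  vertex-length = let (_ , _ , _ , _ , _ , len-v , _) = two in len-v

  critical-below-top≡vertex : ∀ {σ} → Critical S V σ → ¬ length σ ≡ suc d → σ ≡ vertex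
  critical-below-top≡vertex crit len≢top =
    let (_ , _ , _ , len-top , _ , _ , _ , top-or-vertex) = two
    in [ (λ { refl → contradiction len-top len≢top }) , id ]′ (top-or-vertex crit)

critical-not-paired-down : ∀ {S V σ d} → Critical S V σ → length σ ≡ suc (suc d) → ∀ {a} → (a , σ) ∉ V
critical-not-paired-down (_ , _ , inj₁ unpaired)    _      aσ∈V = unpaired aσ∈V (inj₂ refl)
critical-not-paired-down (_ , _ , inj₂ (len≡1 , _)) len≡2+ _ with trans (sym len≡1) len≡2+
... | ()

module Flow {S : SimplicialComplex} {V : Pairs} (dvf : DiscreteVF S V)
            {τ : Simplex} (τ∈S : τ ∈S S) (τ-not-paired-down : ∀ {a} → (a , τ) ∉ V)
            {Ps : List (List (Simplex × Simplex))} (enum : EnumeratesTraj V τ Ps)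
  where

  open DiscreteVF dvf

  private
    Ps-unique : Unique Ps
    Ps-unique = proj₁ enum

    traj : ∀ {P} → P ∈ Ps → IsTraj V τ P
    traj = proj₁ (proj₂ enum)

    enumerated : ∀ {P} → IsTraj V τ P → P ∈ Ps
    enumerated = proj₂ (proj₂ enum)

    term∈S : ∀ {P} → P ∈ Ps → term τ P ∈S S
    term∈S {P} P∈Ps = term-∈S dvf P τ∈S (traj P∈Ps)

    term-sorted : ∀ {P} → P ∈ Ps → IsSimplex (term τ P)
    term-sorted = sorted S ∘ term∈S

  ∂flow : Simplex → ℤ
  ∂flow α = ∑[ P ∈ Ps ] weight τ P * inc (term τ P) α

  ∂-coeff-flowChain : ∀ q ρ → ∂-coeff (suc q) (flowChain τ Ps) ρ ≡ ∂flow ρ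
  ∂-coeff-flowChain q ρ = ∑-map Ps (λ P → weight τ P , term τ P) (λ p → proj₁ p * inc (proj₂ p) ρ)

  ∂flow-support : ∀ {α} → ¬ ∂flow α ≡ 0ℤ → α ∈S S × length τ ≡ suc (length α)
  ∂flow-support {α} ∂α≢0 with ∑≢0⇒∃≢0 Ps _ ∂α≢0
  ... | P , P∈Ps , w*inc≢0 =
    let sα , α⊆t , len = inc≢0⇒facet (term-sorted P∈Ps) (proj₂ (*≢0⇒≢0 (weight τ P) (inc (term τ P) α) w*inc≢0))
    in closed S (term∈S P∈Ps) sα α⊆t , trans (sym (term-length dvf P (traj P∈Ps))) len

  simplices! : List Simplex
  simplices! = deduplicate _≟S_ (simplices S)

  simplices!-unique : Unique simplices!
  simplices!-unique = DecUnique.deduplicate-! _≟S_ (simplices S)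

  ∈-simplices! : ∀ {σ} → σ ∈S S → σ ∈ simplices!
  ∈-simplices! = ∈-deduplicate⁺ _≟S_

  ∂∂flow : ∀ γ → ∑[ α ∈ simplices! ] ∂flow α * inc α γ ≡ 0ℤ
  ∂∂flow γ = begin
    ∑[ α ∈ simplices! ] ∂flow α * inc α γ
      ≡⟨ ∑-cong simplices! (λ {α} _ → sym (∑-*ʳ Ps (inc α γ) _)) ⟩
    ∑[ α ∈ simplices! ] ∑[ P ∈ Ps ] weight τ P * inc (term τ P) α * inc α γ
      ≡⟨ ∑-comm simplices! Ps _ ⟩
    ∑[ P ∈ Ps ] ∑[ α ∈ simplices! ] weight τ P * inc (term τ P) α * inc α γ
      ≡⟨ ∑-cong Ps (λ {P} _ → trans (∑-cong simplices! (λ {α} _ → ℤ.*-assoc (weight τ P) (inc (term τ P) α) (inc α γ)))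
                                    (∑-*ˡ simplices! (weight τ P) _)) ⟩
    ∑[ P ∈ Ps ] weight τ P * (∑[ α ∈ simplices! ] inc (term τ P) α * inc α γ)
      ≡⟨ ∑-zero Ps (λ {P} P∈Ps → trans (cong (weight τ P *_) (∂∂-term P∈Ps)) (ℤ.*-zeroʳ (weight τ P))) ⟩
    0ℤ ∎
    where
    open ≡-Reasoning
    ∂∂-term : ∀ {P} → P ∈ Ps → ∑[ α ∈ simplices! ] inc (term τ P) α * inc α γ ≡ 0ℤ
    ∂∂-term P∈Ps = trans
      (∑-inc≡⟨boundary⟩ (term-sorted P∈Ps) simplices!-unique
        (λ p∈ → ∈-simplices! (closed S (term∈S P∈Ps) (boundary-sorted (term-sorted P∈Ps) p∈)
                                       (proj₁ (boundary-facet p∈))))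
        (λ α → inc α γ))
      (∂∂≡0 (term-sorted P∈Ps) γ)

  private module PairedUp {ρ β : Simplex} (ρβ∈V : (ρ , β) ∈ V) where

    ι : ℤ
    ι = inc β ρ

    ends-at-β? : Decidable (λ P → term τ P ≡ β)
    ends-at-β? P = term τ P ≟S β

    arrivals others : List (List (Simplex × Simplex))
    arrivals = filter ends-at-β? Ps
    others   = filter (¬? ∘ ends-at-β?) Ps

    ∂others : ℤ
    ∂others = ∑[ Q ∈ others ] weight τ Q * inc (term τ Q) ρ

    extend : List (Simplex × Simplex) → List (Simplex × Simplex)
    extend Q = Q ∷ʳ (ρ , β)

    weight-extend : ∀ Q → weight τ (extend Q) ≡ - (weight τ Q * inc (term τ Q) ρ * ι)
    weight-extend Q = begin
      weight τ (Q ++ (ρ , β) ∷ [])    ≡⟨ weight-++ τ Q ((ρ , β) ∷ []) ⟩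
      w * (- (c * ι) * 1ℤ)            ≡⟨ cong (w *_) (ℤ.*-identityʳ (- (c * ι))) ⟩
      w * - (c * ι)                   ≡⟨ ℤ.neg-distribʳ-* w (c * ι) ⟨
      - (w * (c * ι))                 ≡⟨ cong -_ (ℤ.*-assoc w c ι) ⟨
      - (w * c * ι)                   ∎
      where
      open ≡-Reasoning
      w = weight τ Q
      c = inc (term τ Q) ρ

    arrival⇒extension : ∀ {P} → P ∈ arrivals → P ∈ map extend others
    arrival⇒extension {P} P∈ = by-last-step (initLast P) (∈-filter⁻ ends-at-β? P∈)
      where
      by-last-step : ∀ {P} → InitLast P → P ∈ Ps × term τ P ≡ β → P ∈ map extend others
      by-last-step [] (_ , τ≡β) = contradiction (subst (λ σ → (ρ , σ) ∈ V) (sym τ≡β) ρβ∈V) τ-not-paired-down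
      by-last-step (Q ∷ʳ′ (a , b)) (P∈Ps , ends) with IsTraj-++⁻ Q (traj P∈Ps)
      ... | trajQ , (ab∈V , _ , _ , t≢b , _)
        with refl ← atMost1 ab∈V ρβ∈V (inj₂ (sym (trans (sym (term-++ τ Q _)) ends))) (inj₂ refl) =
        ∈-map⁺ extend (∈-filter⁺ (¬? ∘ ends-at-β?) (enumerated trajQ) t≢b)

    extension⇒arrival : ∀ {P} → ¬ weight τ P ≡ 0ℤ → P ∈ map extend others → P ∈ arrivals
    extension⇒arrival w≢0 P∈ with ∈-map⁻ extend P∈
    ... | Q , Q∈others , refl with ∈-filter⁻ (¬? ∘ ends-at-β?) Q∈others
    ... | Q∈Ps , t≢β = ∈-filter⁺ ends-at-β? (enumerated (IsTraj-++⁺ Q (traj Q∈Ps) last-step)) (term-++ τ Q _)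
      where
      inc≢0 : ¬ inc (term τ Q) ρ ≡ 0ℤ
      inc≢0 c≡0 = w≢0 (trans (weight-extend Q)
        (cong (λ t → - (t * ι)) (trans (cong (weight τ Q *_) c≡0) (ℤ.*-zeroʳ (weight τ Q)))))
      last-step : IsTraj V (term τ Q) ((ρ , β) ∷ [])
      last-step with inc≢0⇒facet (term-sorted Q∈Ps) inc≢0
      ... | _ , ρ⊆t , len = ρβ∈V , len , facet⇒⊊ (ρ⊆t , len) , t≢β , tt

    ∑-arrivals : ∑ arrivals (weight τ) ≡ - (∂others * ι)
    ∑-arrivals = begin
      ∑ arrivals (weight τ)
        ≡⟨ ∑-same-support (weight τ) (Unique.filter⁺ ends-at-β? Ps-unique) extensions-unique
                  (λ w≢0 → mk⇔ arrival⇒extension (extension⇒arrival w≢0)) ⟩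
      ∑ (map extend others) (weight τ)
        ≡⟨ ∑-map others extend (weight τ) ⟩
      ∑[ Q ∈ others ] weight τ (extend Q)
        ≡⟨ ∑-cong others (λ {Q} _ → weight-extend Q) ⟩
      ∑[ Q ∈ others ] - (weight τ Q * inc (term τ Q) ρ * ι)
        ≡⟨ ∑-neg others _ ⟩
      - (∑[ Q ∈ others ] weight τ Q * inc (term τ Q) ρ * ι)
        ≡⟨ cong -_ (∑-*ʳ others ι _) ⟩
      - (∂others * ι) ∎
      where
      open ≡-Reasoning
      extensions-unique : Unique (map extend others)
      extensions-unique = Unique.map⁺ (∷ʳ-injectiveˡ _ _) (Unique.filter⁺ (¬? ∘ ends-at-β?) Ps-unique)

  ∂flow-paired-up : ∀ {ρ β} → (ρ , β) ∈ V → ∂flow ρ ≡ 0ℤ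
  ∂flow-paired-up {ρ} {β} ρβ∈V = begin
    ∂flow ρ                                         ≡⟨ ∑-partition ends-at-β? Ps _ ⟩
    (∑[ P ∈ arrivals ] weight τ P * inc (term τ P) ρ) + ∂others
      ≡⟨ cong (_+ ∂others) (∑-cong arrivals (λ {P} P∈ → cong (λ σ → weight τ P * inc σ ρ)
                                                              (proj₂ (∈-filter⁻ ends-at-β? {xs = Ps} P∈)))) ⟩
    (∑[ P ∈ arrivals ] weight τ P * ι) + ∂others           ≡⟨ cong (_+ ∂others) (∑-*ʳ arrivals ι (weight τ)) ⟩
    ∑ arrivals (weight τ) * ι + ∂others             ≡⟨ cong (λ s → s * ι + ∂others) ∑-arrivals ⟩
    - (∂others * ι) * ι + ∂others                   ≡⟨ cong (_+ ∂others) (ℤ.neg-distribˡ-* (∂others * ι) ι) ⟨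
    - (∂others * ι * ι) + ∂others                   ≡⟨ cong (λ s → - s + ∂others) (ℤ.*-assoc ∂others ι ι) ⟩
    - (∂others * (ι * ι)) + ∂others                 ≡⟨ cong (λ s → - (∂others * s) + ∂others) ι²≡1 ⟩
    - (∂others * 1ℤ) + ∂others                      ≡⟨ cong (λ s → - s + ∂others) (ℤ.*-identityʳ ∂others) ⟩
    - ∂others + ∂others                             ≡⟨ ℤ.+-inverseˡ ∂others ⟩
    0ℤ                                              ∎
    where
    open ≡-Reasoning
    open PairedUp ρβ∈V
    ι²≡1 : ι * ι ≡ 1ℤ
    ι²≡1 = facet⇒inc²≡1 (sorted S (proj₂ (inS ρβ∈V))) (sorted S (proj₁ (inS ρβ∈V))) (facet ρβ∈V)

  ∂flow-paired-down-or-unpaired : ∀ {α} → ¬ ∂flow α ≡ 0ℤ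
                                → (∃[ a ] (a , α) ∈ V) ⊎ (∀ {p} → p ∈ V → ¬ OccursIn α p)
  ∂flow-paired-down-or-unpaired {α} ∂α≢0 with any? (λ (a , b) → α ≟S a ⊎-dec α ≟S b) V
  ... | no none = inj₂ (λ p∈V α∈p → none (Any.map (λ { refl → α∈p }) p∈V))
  ... | yes some with find some
  ...   | (a , b) , ab∈V , inj₁ refl = contradiction (∂flow-paired-up ab∈V) ∂α≢0
  ...   | (a , b) , ab∈V , inj₂ refl = inj₁ (a , ab∈V)

  -- ∂∂ = 0 at a: the term of α in ∑ ∂flow σ [σ,a] is nonzero, so another term must be.
  ∂flow-backward-step : ∀ {a α} → (a , α) ∈ V → ¬ ∂flow α ≡ 0ℤ
                      → ∃[ α′ ] (¬ ∂flow α′ ≡ 0ℤ × IsTraj V α′ ((a , α) ∷ []))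
  ∂flow-backward-step {a} {α} aα∈V ∂α≢0 =
    let α′ , _ , α′≢α , ∂α′*inc≢0 = ∑≡0⇒∃≢0-elsewhere _≟S_ (λ σ → ∂flow σ * inc σ a) simplices!-unique
                                      (∈-simplices! (proj₂ (inS aα∈V))) (∂∂flow a) ∂α*inc≢0
        ∂α′≢0 , inc≢0 = *≢0⇒≢0 (∂flow α′) (inc α′ a) ∂α′*inc≢0
        _ , a⊆α′ , len = inc≢0⇒facet (sorted S (proj₁ (∂flow-support ∂α′≢0))) inc≢0
    in α′ , ∂α′≢0 , (aα∈V , len , facet⇒⊊ (a⊆α′ , len) , α′≢α , tt)
    where
    ∂α*inc≢0 : ¬ ∂flow α * inc α a ≡ 0ℤ
    ∂α*inc≢0 ∂α*inc≡0 with ℤ.i*j≡0⇒i≡0∨j≡0 (∂flow α) ∂α*inc≡0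
    ... | inj₁ ∂α≡0  = ∂α≢0 ∂α≡0
    ... | inj₂ inc≡0 =
      facet⇒inc≢0 (sorted S (proj₂ (inS aα∈V))) (sorted S (proj₁ (inS aα∈V))) (facet aα∈V) inc≡0

  ∂flow-single-vertex : ∀ {v} → length v ≡ 1 → (∀ {α} → ¬ ∂flow α ≡ 0ℤ → α ≡ v)
                      → ∀ α → ∂flow α ≡ 0ℤ
  ∂flow-single-vertex {v} len-v only-v α with ∂flow α ℤ.≟ 0ℤ
  ... | yes ∂α≡0 = ∂α≡0
  ... | no ∂α≢0 with refl ← only-v ∂α≢0 = begin
    ∂flow v                                ≡⟨ ℤ.*-identityʳ (∂flow v) ⟨
    ∂flow v * 1ℤ                           ≡⟨ cong (∂flow v *_) (inc-vertex-[] {v} len-v) ⟨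
    ∂flow v * inc v []                     ≡⟨ ∑-single (λ σ → ∂flow σ * inc σ []) simplices!-unique
                                                (∈-simplices! (proj₁ (∂flow-support ∂α≢0))) vanishes-off-v ⟨
    ∑[ σ ∈ simplices! ] ∂flow σ * inc σ [] ≡⟨ ∂∂flow [] ⟩
    0ℤ                                     ∎
    where
    open ≡-Reasoning
    vanishes-off-v : ∀ {σ} → σ ∈ simplices! → ¬ σ ≡ v → ∂flow σ * inc σ [] ≡ 0ℤ
    vanishes-off-v {σ} _ σ≢v with ∂flow σ ℤ.≟ 0ℤ
    ... | yes ∂σ≡0 = cong (_* inc σ []) ∂σ≡0
    ... | no ∂σ≢0  = contradiction (only-v ∂σ≢0) σ≢v

  ∂flow≡0-dim1 : TwoCritical 1 S V → length τ ≡ 2 → ∀ α → ∂flow α ≡ 0ℤ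
  ∂flow≡0-dim1 two len-τ = ∂flow-single-vertex vertex-length nonzero⇒vertex
    where
    open TwoCriticalFacts {1} {S} {V} two
    nonzero⇒vertex : ∀ {α} → ¬ ∂flow α ≡ 0ℤ → α ≡ vertex
    nonzero⇒vertex {α} ∂α≢0 =
      critical-below-top≡vertex critical (λ len≡2 → contradiction (trans (sym len-α) len≡2) λ ())
      where
      α∈S : α ∈S S
      α∈S = proj₁ (∂flow-support ∂α≢0)
      len-α : length α ≡ 1
      len-α = ℕ.suc-injective (trans (sym (proj₂ (∂flow-support ∂α≢0))) len-τ)
      α≢∅ : ¬ α ≡ []
      α≢∅ refl = ℕ.0≢1+n len-α
      critical : Critical S V α
      critical with ∂flow-paired-down-or-unpaired ∂α≢0
      ... | inj₁ (_ , aα∈V) = α∈S , α≢∅ , inj₂ (len-α , vertex-paired-down-by-∅ dvf aα∈V len-α)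
      ... | inj₂ unpaired   = α∈S , α≢∅ , inj₁ unpaired

  ∂flow≡0-dim≥2 : ∀ {d} → Gradient S V → TwoCritical (suc (suc d)) S V → length τ ≡ suc (suc (suc d))
                → ∀ α → ∂flow α ≡ 0ℤ
  ∂flow≡0-dim≥2 {d} grad two len-τ α =
    decidable-stable (∂flow α ℤ.≟ 0ℤ)
      (gradient⇒no-backward-closed {S} {V} grad {P = λ σ → ¬ ∂flow σ ≡ 0ℤ}
                                   (λ ∂σ≢0 → proj₁ (∂flow-support ∂σ≢0)) step-back {α})
    where
    open TwoCriticalFacts {suc (suc d)} {S} {V} two
    paired-down : ∀ {α} → ¬ ∂flow α ≡ 0ℤ → ∃[ a ] (a , α) ∈ V
    paired-down {α} ∂α≢0 with ∂flow-paired-down-or-unpaired ∂α≢0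
    ... | inj₁ aα∈V     = aα∈V
    ... | inj₂ unpaired = contradiction (trans (sym len-α) (trans (cong length α≡vertex) vertex-length)) λ ()
      where
      len-α : length α ≡ suc (suc d)
      len-α = ℕ.suc-injective (trans (sym (proj₂ (∂flow-support ∂α≢0))) len-τ)
      α≡vertex : α ≡ vertex
      α≡vertex = critical-below-top≡vertex
        (proj₁ (∂flow-support ∂α≢0) , (λ { refl → ℕ.0≢1+n len-α }) , inj₁ unpaired)
        (λ len≡top → ℕ.1+n≢n (trans (sym len≡top) len-α))
    step-back : ∀ {α} → ¬ ∂flow α ≡ 0ℤ → ∃[ α′ ] ∃[ a ] (¬ ∂flow α′ ≡ 0ℤ × IsTraj V α′ ((a , α) ∷ []))
    step-back ∂α≢0 =
      let a , aα∈V = paired-down ∂α≢0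
          α′ , ∂α′≢0 , α′→α = ∂flow-backward-step aα∈V ∂α≢0
      in α′ , a , ∂α′≢0 , α′→α

lemma4p7 : (d : ℕ) (S : SimplicialComplex) → CombSphere d S
    → (V : Pairs) → DiscreteVF S V → Gradient S V → TwoCritical d S V
    → (τ : Simplex) → Critical S V τ → length τ ≡ suc d
    → (Ps : List (List (Simplex × Simplex))) → EnumeratesTraj V τ Ps
    → (ρ : Simplex) → ∂-coeff d (flowChain τ Ps) ρ ≡ 0ℤ
lemma4p7 zero _ _ _ _ _ _ _ _ _ _ _ _ = refl
lemma4p7 (suc d) S _ V dvf grad two τ τ-crit len-τ Ps enum ρ =
  trans (∂-coeff-flowChain d ρ) (∂flow≡0 d two len-τ ρ)
  where
  open Flow dvf (proj₁ τ-crit) (critical-not-paired-down {S} {V} {τ} τ-crit len-τ) enum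
  ∂flow≡0 : ∀ d → TwoCritical (suc d) S V → length τ ≡ suc (suc d) → ∀ α → ∂flow α ≡ 0ℤ
  ∂flow≡0 zero    = ∂flow≡0-dim1
  ∂flow≡0 (suc d) = ∂flow≡0-dim≥2 grad
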